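{- Let $X\subseteq\omega$ be an infinite set with uniqueness of sums, let $u\in\beta\omega$ be an $X$-adequate ultrafilter, and let $A\in u$ be an $X$-adequate set. Then $\mathrm{FS}^X_n(A)\in u^n$ for every $n\in\mathbb N$.
   Context: $\mathrm{FS}(B)$ is the set of sums of finite nonempty subsets of $B$. $B\subseteq\omega$ has uniqueness of sums if whenever $a_1<\dots<a_n$, $b_1<\dots<b_m$ in $B$ have equal sums, $n=m$ and $a_i=b_i$. Let $\langle x_n : n<\omega\rangle$ be the increasing enumeration of $X$. A finite sequence $\langle a_1,\dots,a_n\rangle$ is a sum subsystem of $\langle x_n\rangle$ if there are finite nonempty sets $H_1,\dots,H_n\subseteq\omega$ with $\max H_i<\min H_{i+1}$ and $a_i=\sum_{j\in H_i}x_j$. For $A\subseteq\mathrm{FS}(X)$, $\mathrm{FS}^X_n(A)$ is the set of sums $a_1+\dots+a_n$ of distinct $a_i\in A$ such that $\langle a_1,\dots,a_n\rangle$ is a sum subsystem of $\langle x_n\rangle$. $A$ is $X$-adequate if $A\subseteq\mathrm{FS}(X)$ and for every subsequence $\langle x_{n_k}:k\ge1\rangle$ there is a unique $m\ge1$ with $x_{n_1}+\dots+x_{n_m}\in A$; $u$ is $X$-adequate if some $X$-adequate set is in $u$ and $\mathrm{FS}(Y)\in u$ for every cofinite $Y\subseteq X$. $u+v=\{B : \{x : \{y : x+y\in B\}\in v\}\in u\}$, $u^n=u+\cdots+u$ ($n$ times). -}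

module Defs where

open import Level using (0ℓ)
open import Data.Nat using (ℕ; zero; suc; _+_; _<_; _≤_)
open import Data.Product using (Σ; ∃; _×_; _,_)
open import Data.Sum using (_⊎_)
open import Data.Empty using (⊥)
open import Data.Unit using (⊤)
open import Data.List using (List; []; _∷_; map; length)
open import Data.Nat.ListAction using (sum)
open import Data.List.NonEmpty as L⁺ using (List⁺)
open import Data.List.Relation.Unary.All using (All)
open import Data.List.Relation.Unary.Linked using (Linked)
open import Data.List.Relation.Unary.Unique.Propositional using (Unique)
open import Relation.Binary.PropositionalEquality using (_≡_; _≢_)
open import Relation.Nullary using (¬_)

Subset : Set₁
Subset = ℕ → Set

_⊆_ : Subset → Subset → Set
B ⊆ C = ∀ m → B m → C m

-- An infinite X ⊆ ω is given by its increasing enumeration x : ℕ → ℕ.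
StrictlyIncreasing : (ℕ → ℕ) → Set
StrictlyIncreasing f = ∀ i j → i < j → f i < f j

rangeOf : (ℕ → ℕ) → Subset
rangeOf x m = ∃ λ n → x n ≡ m

Increasing : List ℕ → Set
Increasing = Linked _<_

FS : Subset → Subset
FS B m = Σ (List⁺ ℕ) λ l → Increasing (L⁺.toList l) × All B (L⁺.toList l)
           × sum (L⁺.toList l) ≡ m

UniquenessOfSums : Subset → Set
UniquenessOfSums B = ∀ (as bs : List ℕ) → Increasing as → Increasing bs
  → All B as → All B bs → sum as ≡ sum bs → as ≡ bs

-- Blocks H₁,...,Hₙ: finite nonempty index sets, each given as a strictly
-- increasing nonempty list, with max Hᵢ < min Hᵢ₊₁.
BlockOK : List⁺ ℕ → Set
BlockOK H = Increasing (L⁺.toList H)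

Consecutive : List⁺ ℕ → List⁺ ℕ → Set
Consecutive H K = L⁺.last H < L⁺.head K

blockSum : (ℕ → ℕ) → List⁺ ℕ → ℕ
blockSum x H = sum (map x (L⁺.toList H))

SumSubsystem : (ℕ → ℕ) → List ℕ → Set
SumSubsystem x as = Σ (List (List⁺ ℕ)) λ Hs →
  All BlockOK Hs × Linked Consecutive Hs × map (blockSum x) Hs ≡ as

FSn : (ℕ → ℕ) → ℕ → Subset → Subset
FSn x n A m = Σ (List ℕ) λ as → length as ≡ n × Unique as × All A as
  × SumSubsystem x as × sum as ≡ m

-- x_{n_1} + ... + x_{n_m}, where the subsequence is k ↦ x (s k), k = 0,1,...
-- (the paper's index k ≥ 1 is shifted to k ≥ 0).
partialSum : (ℕ → ℕ) → ℕ → ℕ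
partialSum f zero = 0
partialSum f (suc m) = partialSum f m + f m

AdequateSet : (ℕ → ℕ) → Subset → Set
AdequateSet x A = (A ⊆ FS (rangeOf x)) ×
  (∀ (s : ℕ → ℕ) → StrictlyIncreasing s →
     Σ ℕ λ m → 1 ≤ m × A (partialSum (λ k → x (s k)) m) ×
       (∀ m' → 1 ≤ m' → A (partialSum (λ k → x (s k)) m') → m' ≡ m))

SetFamily : Set₁
SetFamily = Subset → Set

record IsUltrafilter (u : SetFamily) : Set₁ where
  field
    upward   : ∀ B C → B ⊆ C → u B → u C
    inter    : ∀ B C → u B → u C → u (λ m → B m × C m)
    whole    : u (λ _ → ⊤)
    noEmpty  : ¬ u (λ _ → ⊥)
    ultra    : ∀ B → u B ⊎ u (λ m → ¬ B m)

CofiniteIn : Subset → Subset → Set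
CofiniteIn Y X = (Y ⊆ X) × (Σ ℕ λ k → ∀ m → X m → ¬ Y m → m < k)

AdequateUltrafilter : (ℕ → ℕ) → SetFamily → Set₁
AdequateUltrafilter x u = (Σ Subset λ A → AdequateSet x A × u A) ×
  (∀ Y → CofiniteIn Y (rangeOf x) → u (FS Y))

_⊕_ : SetFamily → SetFamily → SetFamily
(u ⊕ v) B = u (λ a → v (λ b → B (a + b)))

pow : SetFamily → ℕ → SetFamily
pow u zero = u   -- junk value; only n ≥ 1 is used
pow u (suc zero) = u
pow u (suc (suc n)) = u ⊕ pow u (suc n)

{-# OPTIONS --safe #-}
-- Write Tail k = {x_j : j ≥ k}. Each FS(Tail k) is in u, hence so is the set of
-- a ∈ A that are sums of a block of indices ≥ k. Since u^(n+1) = u + u^n,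
-- induction on n shows that u^n contains the sums a₁ + ⋯ + aₙ of chains of such
-- blocks, each starting beyond the indices and the sum of the previous one.
-- Such a chain is a sum subsystem with strictly increasing terms, so its sum
-- lies in FS^X_n(A).
module Submission where

open import Defs
open import Data.Nat using (ℕ; zero; suc; _+_; _<_; _≤_; z≤n; s≤s)
open import Data.Nat.Properties
open import Data.Product using (Σ; ∃; _×_; _,_)
open import Data.Empty using (⊥-elim)
open import Data.List using (List; []; _∷_; map; length)
open import Data.List.Properties using (length-map)
open import Data.Nat.ListAction using (sum)
open import Data.List.NonEmpty as L⁺ using (List⁺; _∷_)
open import Data.List.Relation.Unary.All using (All; []; _∷_)
import Data.List.Relation.Unary.AllPairs as AllPairs
open import Data.List.Relation.Unary.Linked using (Linked; []; [-]; _∷_)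
open import Data.List.Relation.Unary.Linked.Properties using (Linked⇒AllPairs)
open import Data.List.Relation.Unary.Unique.Propositional using (Unique)
open import Relation.Binary using (tri<; tri≈; tri>)
open import Relation.Binary.PropositionalEquality
open import Relation.Nullary using (¬_; yes; no)

pow-mono : ∀ {u} → IsUltrafilter u → ∀ n {B C} → B ⊆ C → pow u n B → pow u n C
pow-mono U zero          B⊆C = IsUltrafilter.upward U _ _ B⊆C
pow-mono U (suc zero)    B⊆C = IsUltrafilter.upward U _ _ B⊆C
pow-mono U (suc (suc n)) B⊆C =
  IsUltrafilter.upward U _ _ (λ a → pow-mono U (suc n) (λ b → B⊆C (a + b)))

Tail : (ℕ → ℕ) → ℕ → Subset
Tail x k m = ∃ λ j → k ≤ j × x j ≡ m

module _ {x : ℕ → ℕ} (x-inc : StrictlyIncreasing x) where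

  inflationary : ∀ n → n ≤ x n
  inflationary zero    = z≤n
  inflationary (suc n) = ≤-trans (s≤s (inflationary n)) (x-inc n (suc n) (n<1+n n))

  reflects-< : ∀ {i j} → x i < x j → i < j
  reflects-< {i} {j} xi<xj with <-cmp i j
  ... | tri< i<j _ _ = i<j
  ... | tri≈ _ refl _ = ⊥-elim (<-irrefl refl xi<xj)
  ... | tri> _ _ j<i = ⊥-elim (<-asym xi<xj (x-inc j i j<i))

  reflects-Increasing : ∀ js → Increasing (map x js) → Increasing js
  reflects-Increasing []            _          = []
  reflects-Increasing (_ ∷ [])      _          = [-]
  reflects-Increasing (_ ∷ j ∷ js) (x<x ∷ inc) = reflects-< x<x ∷ reflects-Increasing (j ∷ js) inc

  Tail-cofinite : ∀ k → CofiniteIn (Tail x k) (rangeOf x)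
  Tail-cofinite k = (λ { m (j , _ , xj≡m) → j , xj≡m }) , x k , below
    where
    below : ∀ m → rangeOf x m → ¬ Tail x k m → m < x k
    below m (j , xj≡m) m∉Tail with j <? k
    ... | yes j<k = subst (_< x k) xj≡m (x-inc j k j<k)
    ... | no  j≮k = ⊥-elim (m∉Tail (j , ≮⇒≥ j≮k , xj≡m))

  Tail-indices : ∀ {k} ms → All (Tail x k) ms → Σ (List ℕ) λ js → All (k ≤_) js × map x js ≡ ms
  Tail-indices []       []                      = [] , [] , refl
  Tail-indices (_ ∷ ms) ((j , k≤j , refl) ∷ ts) with Tail-indices ms ts
  ... | js , k≤js , refl = j ∷ js , k≤j ∷ k≤js , refl

  FS-Tail⇒blockSum : ∀ {k a} → FS (Tail x k) a →
    Σ (List⁺ ℕ) λ H → BlockOK H × k ≤ L⁺.head H × blockSum x H ≡ a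
  FS-Tail⇒blockSum (h ∷ t , inc , ts , sum≡a) with Tail-indices (h ∷ t) ts
  ... | j ∷ js , k≤j ∷ _ , refl = j ∷ js , reflects-Increasing (j ∷ js) inc , k≤j , sum≡a

  head≤blockSum : ∀ H → L⁺.head H ≤ blockSum x H
  head≤blockSum (j ∷ js) = ≤-trans (inflationary j) (m≤m+n (x j) _)

  module Chains (A : Subset) where

    Admissible : ℕ → List⁺ ℕ → Set
    Admissible k H = BlockOK H × k ≤ L⁺.head H × A (blockSum x H)

    -- Starting beyond L⁺.last H keeps the blocks consecutive; starting beyond
    -- blockSum x H makes the block sums increase.
    after : List⁺ ℕ → ℕ
    after H = suc (L⁺.last H + blockSum x H)

    data Chain : ℕ → List (List⁺ ℕ) → Set where
      []  : ∀ {k} → Chain k []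
      _∷_ : ∀ {k H Hs} → Admissible k H → Chain (after H) Hs → Chain k (H ∷ Hs)

    ChainSums : ℕ → ℕ → Subset
    ChainSums k n m = Σ (List (List⁺ ℕ)) λ Hs →
      length Hs ≡ n × Chain k Hs × sum (map (blockSum x) Hs) ≡ m

    Chain⇒BlockOK : ∀ {k Hs} → Chain k Hs → All BlockOK Hs
    Chain⇒BlockOK []                    = []
    Chain⇒BlockOK ((ok , _ , _) ∷ chain) = ok ∷ Chain⇒BlockOK chain

    Chain⇒A : ∀ {k Hs} → Chain k Hs → All A (map (blockSum x) Hs)
    Chain⇒A []                    = []
    Chain⇒A ((_ , _ , a) ∷ chain) = a ∷ Chain⇒A chain

    Chain⇒Consecutive : ∀ {k Hs} → Chain k Hs → Linked Consecutive Hs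
    Chain⇒Consecutive []                      = []
    Chain⇒Consecutive (_ ∷ [])                = [-]
    Chain⇒Consecutive (_ ∷ chain@((_ , after≤h , _) ∷ _)) =
      <-≤-trans (s≤s (m≤m+n _ _)) after≤h ∷ Chain⇒Consecutive chain

    Chain⇒sums-increasing : ∀ {k Hs} → Chain k Hs → Increasing (map (blockSum x) Hs)
    Chain⇒sums-increasing []       = []
    Chain⇒sums-increasing (_ ∷ []) = [-]
    Chain⇒sums-increasing {Hs = H ∷ H′ ∷ _} (_ ∷ chain@((_ , after≤h , _) ∷ _)) =
      <-≤-trans (s≤s (m≤n+m _ (L⁺.last H))) (≤-trans after≤h (head≤blockSum H′))
      ∷ Chain⇒sums-increasing chain

    Chain⇒Unique : ∀ {k Hs} → Chain k Hs → Unique (map (blockSum x) Hs)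
    Chain⇒Unique chain =
      AllPairs.map <⇒≢ (Linked⇒AllPairs <-trans (Chain⇒sums-increasing chain))

    ChainSums⊆FSn : ∀ {k n} → ChainSums k n ⊆ FSn x n A
    ChainSums⊆FSn m (Hs , refl , chain , sum≡m) =
      map (blockSum x) Hs , length-map (blockSum x) Hs , Chain⇒Unique chain , Chain⇒A chain ,
      (Hs , Chain⇒BlockOK chain , Chain⇒Consecutive chain , refl) , sum≡m

    module _ {u : SetFamily} (U : IsUltrafilter u) (uA : u A)
             (u-FS : ∀ Y → CofiniteIn Y (rangeOf x) → u (FS Y)) where
      open IsUltrafilter U

      AdmissibleSums : ℕ → Subset
      AdmissibleSums k a = Σ (List⁺ ℕ) λ H → Admissible k H × blockSum x H ≡ a

      u-AdmissibleSums : ∀ k → u (AdmissibleSums k)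
      u-AdmissibleSums k = upward _ _ admissible (inter _ _ uA (u-FS (Tail x k) (Tail-cofinite k)))
        where
        admissible : ∀ a → A a × FS (Tail x k) a → AdmissibleSums k a
        admissible a (Aa , fs) with FS-Tail⇒blockSum fs
        ... | H , ok , k≤h , refl = H , (ok , k≤h , Aa) , refl

      u^n-ChainSums : ∀ n k → pow u (suc n) (ChainSums k (suc n))
      u^n-ChainSums zero k = upward _ _ single (u-AdmissibleSums k)
        where
        single : AdmissibleSums k ⊆ ChainSums k 1
        single a (H , adm , refl) = H ∷ [] , refl , adm ∷ [] , +-identityʳ _
      u^n-ChainSums (suc n) k = upward _ _ extend (u-AdmissibleSums k)
        where
        extend : ∀ a → AdmissibleSums k a → pow u (suc n) (λ b → ChainSums k (suc (suc n)) (a + b))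
        extend a (H , adm , refl) = pow-mono U (suc n) prepend (u^n-ChainSums n (after H))
          where
          prepend : ChainSums (after H) (suc n) ⊆ (λ b → ChainSums k (suc (suc n)) (a + b))
          prepend b (Hs , len , chain , refl) = H ∷ Hs , cong suc len , adm ∷ chain , refl

-- Elements of FS and FS^X_n carry their representing blocks explicitly.
lemma2p8 : (x : ℕ → ℕ) → StrictlyIncreasing x → UniquenessOfSums (rangeOf x)
    → (u : SetFamily) → IsUltrafilter u → AdequateUltrafilter x u
    → (A : Subset) → AdequateSet x A → u A
    → (n : ℕ) → 1 ≤ n → pow u n (FSn x n A)
lemma2p8 x x-inc _ u U (_ , u-FS) A _ uA (suc n) _ =
  pow-mono U (suc n) ChainSums⊆FSn (u^n-ChainSums U uA u-FS n 0)
  where open Chains x-inc A
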